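{- Let $r\ge 1$, let $V$ be a set of $r+3$ vertices, let $C$ be a cycle of length $\ell$ whose vertex set is a subset of $V$, and let $K_C$ be the cocycle complex associated with $C$. Then: (1) $K_C$ is $r$-path connected; (2) if $\ell=3$, then $K_C$ is the book ${\sf B}_{r+3}^r$; (3) if $\ell=4$, then $K_C$ is the wheel ${\sf W}_{r+3}^r$; (4) if $5\le \ell\le r+3$, then $K_C$ contains no $r$-dimensional wheel.
   Context: A simplicial complex is a family of subsets of a vertex set closed under taking subsets; $i$-faces are members of size $i+1$. The cocycle complex $K_C$ associated with a cycle $C$ (vertices in $V$, $|V|=r+3$) is the $r$-dimensional complex on $V$ whose $r$-faces (facets) are exactly $V\setminus e$ for $e\in E(C)$, together with all their subsets. An $r$-path is a sequence of $r$-faces $F_1,\dots,F_m$ with $F_i\cap F_j$ an $(r-1)$-face iff $|i-j|=1$; a complex is $r$-path connected if any two $r$-faces are joined by an $r$-path. The book ${\sf B}_{n}^r$ is the pure $r$-dimensional complex on $n$ vertices whose $r$-faces are $T\cup\{v\}$ for a fixed $r$-set $T$ and each vertex $v\notin T$. The wheel ${\sf W}_{n}^r$ is the pure $r$-dimensional complex on $n$ vertices whose $r$-faces are $S\cup e$, where $S$ is a fixed $(r-1)$-set and $e$ ranges over the edges of a cycle on the remaining $n-r+1\ge 3$ vertices. A complex contains an $r$-dimensional wheel if there exist an $(r-1)$-set $S$ of vertices and distinct vertices $v_1,\dots,v_k\notin S$, $k\ge 3$, with $S\cup\{v_i,v_{i+1}\}$ an $r$-face for all $i$ (indices mod $k$).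 -}

module Defs where

open import Data.Nat using (ℕ; zero; suc; _+_; _≤_; ∣_-_∣; _∸_)
open import Data.Fin using (Fin; toℕ; fromℕ) renaming (zero to fzero)
open import Data.Fin.Subset using (Subset; ⁅_⁆; _∈_; _∉_; _⊆_; ∁; _∩_; _∪_; ∣_∣)
open import Data.Product using (Σ; ∃; ∃-syntax; _×_; _,_)
open import Data.Sum using (_⊎_)
open import Function using (_⇔_)
open import Function.Definitions using (Injective)
open import Relation.Binary.PropositionalEquality using (_≡_)

-- A (abstract) simplicial complex on the vertex set Fin n, given by its
-- face predicate (closed under subsets in all uses below).
Complex : ℕ → Set₁
Complex n = Subset n → Set

RFace : ∀ {n} → ℕ → Complex n → Subset n → Set
RFace r K F = K F × ∣ F ∣ ≡ suc r

-- A cycle in the vertex set Fin n: distinct vertices v_0,…,v_{ℓ-1}, ℓ ≥ 3,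
-- with edges {v_i, v_{i+1}} (indices mod ℓ).
record Cycle (n : ℕ) : Set where
  field
    len    : ℕ
    len≥3  : 3 ≤ len
    vert   : Fin len → Fin n
    inj    : Injective _≡_ _≡_ vert

open Cycle public

CycAdj : ∀ {ℓ} → Fin ℓ → Fin ℓ → Set
CycAdj {ℓ} i j = (toℕ j ≡ suc (toℕ i)) ⊎ (toℕ i ≡ ℓ ∸ 1 × toℕ j ≡ 0)

edgeSet : ∀ {n} (C : Cycle n) → Fin (len C) → Fin (len C) → Subset n
edgeSet C i j = ⁅ vert C i ⁆ ∪ ⁅ vert C j ⁆

cocycle : ∀ {n} → Cycle n → Complex n
cocycle C F = ∃[ i ] ∃[ j ] (CycAdj i j × F ⊆ ∁ (edgeSet C i j))

IsRPath : ∀ {n} → ℕ → Complex n → (m : ℕ) → (Fin (suc m) → Subset n) → Set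
IsRPath r K m P =
  (∀ i → RFace r K (P i)) ×
  (∀ i j → ((K (P i ∩ P j) × ∣ P i ∩ P j ∣ ≡ r) ⇔ (∣ toℕ i - toℕ j ∣ ≡ 1)))

RPathConnected : ∀ {n} → ℕ → Complex n → Set
RPathConnected r K =
  ∀ F G → RFace r K F → RFace r K G →
  ∃[ m ] Σ (Fin (suc m) → Subset _) λ P →
    IsRPath r K m P × P fzero ≡ F × P (fromℕ m) ≡ G

IsBook : ∀ {n} → ℕ → Complex n → Set
IsBook {n} r K =
  Σ (Subset n) λ T → ∣ T ∣ ≡ r ×
    (∀ F → K F ⇔ (∃[ v ] (v ∉ T × F ⊆ (T ∪ ⁅ v ⁆))))

IsWheel : ∀ {n} → ℕ → Complex n → Set
IsWheel {n} r K =
  Σ (Subset n) λ S → suc ∣ S ∣ ≡ r ×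
    Σ (Cycle n) λ D →
      (∀ x → x ∉ S ⇔ (∃[ i ] vert D i ≡ x)) ×
      (∀ F → K F ⇔ (∃[ i ] ∃[ j ] (CycAdj i j × F ⊆ (S ∪ edgeSet D i j))))

ContainsWheel : ∀ {n} → ℕ → Complex n → Set
ContainsWheel {n} r K =
  Σ (Subset n) λ S → suc ∣ S ∣ ≡ r ×
    Σ (Cycle n) λ D →
      (∀ i → vert D i ∉ S) ×
      (∀ i j → CycAdj i j → RFace r K (S ∪ edgeSet D i j))

{-# OPTIONS --safe #-}

-- The facets of K_C are the sets V ∖ e, e ∈ E(C).  Two of them meet in
-- V ∖ (e ∪ f), which has r vertices exactly when |e ∪ f| = 3, i.e. when e and f
-- are consecutive on C; so r-paths of facets are induced paths in the cycle of
-- edges of C, and an arc of that cycle provides one.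
--
-- For ℓ = 3 (ℓ = 4) the facet V ∖ e contains V ∖ V(C) together with the vertex
-- (the edge) of C opposite to e, and has as many elements as their union.
--
-- If S ∪ {u, w} is a facet, its complement is an edge of C.  For a wheel with
-- centre S and rim d₀, …, d_{k-1}, the complement of the spoke S ∪ {d₀, d₁}
-- contains d₂, …, d_{k-1}, so k ≤ 4.  For k = 4 the complements of the four
-- spokes form a 4-cycle in C; for k = 3 they are three edges of C at the
-- fourth vertex outside S.  Neither can happen in a cycle of length ≥ 5.
module Submission where

open import Defs
open import Data.Nat using (ℕ; _+_; _≤_)
open import Data.Product using (_×_)
open import Relation.Binary.PropositionalEquality using (_≡_)
open import Relation.Nullary using (¬_)

import Algebra.Lattice.Properties.BooleanAlgebra as BooleanAlgebraProperties
open import Data.Empty using (⊥)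
open import Data.Fin as Fin using (Fin; zero; suc; toℕ; fromℕ; fromℕ<; lower₁; opposite; #_)
open import Data.Fin.Properties
  using ( toℕ-injective; toℕ-fromℕ; toℕ-fromℕ<; toℕ-lower₁; toℕ<n; toℕ≤pred[n]
        ; opposite-prop; opposite-involutive)
open import Data.Fin.Subset using (Subset; outside; inside; ⁅_⁆; _∈_; _∉_; _⊆_; ∁; _∩_; _∪_; ∣_∣)
open import Data.Fin.Subset.Properties
  using ( x∈⁅x⁆; x∈⁅y⁆⇒x≡y; x≢y⇒x∉⁅y⁆; ∣⁅x⁆∣≡1; x∈p∪q⁻; x∈p∪q⁺; x∈∁p⇒x∉p; x∉∁p⇒x∈p; x∉p⇒x∈∁p
        ; x∈p⇒x∉∁p; ∣∁p∣≡n∸∣p∣; ∣p∣≤n; ⊆-refl; drop-∷-⊆; p⊆q⇒∣p∣≤∣q∣; p∩q⊆p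
        ; ∪-assoc; ∪-comm; ∪-idem; ∪-identityˡ; ∪-∩-booleanAlgebra)
open import Data.Nat as ℕ using (zero; suc; _∸_; _<_; ∣_-_∣; z≤n; s≤s; _≤?_)
open import Data.Nat.Properties
  using ( +-assoc; +-comm; +-suc; +-identityʳ; +-cancelˡ-≡; m+n∸n≡m; m+[n∸m]≡n; m∸n≤m; m≤n+m
        ; m+n≡0⇒m≡0; ∸-cancelˡ-≡; ∣m+n-m+o∣≡∣n-o∣; ∣-∣-comm; ≤-trans; ≤-reflexive; ≤-antisym
        ; ≤-pred; <⇒≤; <⇒≢; ≰⇒>; m≤n⇒m≤1+n; +-monoʳ-≤; +-mono-≤-<; suc-injective; 0≢1+n)
open import Data.Product using (Σ; ∃-syntax; _,_)
open import Data.Sum as Sum using (_⊎_; inj₁; inj₂)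
open import Data.Sum.Function.Propositional using (_⊎-⇔_)
open import Data.Vec using ([]; _∷_; here; there)
open import Function using (_∘_; id; _⇔_; mk⇔)
open import Function.Definitions using (Injective)
open import Function.Properties.Equivalence using () renaming (sym to ⇔-sym; trans to ⇔-trans)
open import Relation.Binary.PropositionalEquality
  using (refl; sym; trans; cong; cong₂; subst; _≢_; module ≡-Reasoning)
open import Relation.Nullary using (yes; no; contradiction)
open import Relation.Nullary.Decidable using (_×-dec_)

open ≡-Reasoning

∣m-n∣≡1⇔ : ∀ {m n} → ∣ m - n ∣ ≡ 1 ⇔ (n ≡ suc m ⊎ m ≡ suc n)
∣m-n∣≡1⇔ = mk⇔ (to _ _) (from _ _)
  where
  to : ∀ m n → ∣ m - n ∣ ≡ 1 → n ≡ suc m ⊎ m ≡ suc n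
  to zero    _       eq = inj₁ eq
  to (suc m) zero    eq = inj₂ eq
  to (suc m) (suc n) eq = Sum.map (cong suc) (cong suc) (to m n eq)
  from : ∀ m n → n ≡ suc m ⊎ m ≡ suc n → ∣ m - n ∣ ≡ 1
  from zero    _ (inj₁ refl) = refl
  from (suc m) _ (inj₁ refl) = from m _ (inj₁ refl)
  from _ zero    (inj₂ refl) = refl
  from _ (suc n) (inj₂ refl) = from _ n (inj₂ refl)

∣[o∸m]-[o∸n]∣≡∣m-n∣ : ∀ {m n o} → m ≤ o → n ≤ o → ∣ o ∸ m - o ∸ n ∣ ≡ ∣ m - n ∣
∣[o∸m]-[o∸n]∣≡∣m-n∣ {m} {n} {o} m≤o n≤o = begin
  ∣ o ∸ m - o ∸ n ∣                     ≡⟨ ∣m+n-m+o∣≡∣n-o∣ (m + n) (o ∸ m) (o ∸ n) ⟨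
  ∣ m + n + (o ∸ m) - m + n + (o ∸ n) ∣ ≡⟨ cong₂ ∣_-_∣ (shift m n m≤o) (shift′ n m n≤o) ⟩
  ∣ o + n - o + m ∣                     ≡⟨ ∣m+n-m+o∣≡∣n-o∣ o n m ⟩
  ∣ n - m ∣                             ≡⟨ ∣-∣-comm n m ⟩
  ∣ m - n ∣                             ∎
  where
  shift : ∀ i j → i ≤ o → i + j + (o ∸ i) ≡ o + j
  shift i j i≤o = begin
    i + j + (o ∸ i)   ≡⟨ +-assoc i j (o ∸ i) ⟩
    i + (j + (o ∸ i)) ≡⟨ cong (i +_) (+-comm j (o ∸ i)) ⟩
    i + ((o ∸ i) + j) ≡⟨ +-assoc i (o ∸ i) j ⟨
    i + (o ∸ i) + j   ≡⟨ cong (_+ j) (m+[n∸m]≡n i≤o) ⟩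
    o + j             ∎
  shift′ : ∀ i j → i ≤ o → j + i + (o ∸ i) ≡ o + j
  shift′ i j i≤o = trans (cong (_+ (o ∸ i)) (+-comm j i)) (shift i j i≤o)

∣⁅x⁆∪p∣≡1+∣p∣ : ∀ {n} {x : Fin n} {p : Subset n} → x ∉ p → ∣ ⁅ x ⁆ ∪ p ∣ ≡ suc ∣ p ∣
∣⁅x⁆∪p∣≡1+∣p∣ {x = zero}  {outside ∷ p} _   = cong (suc ∘ ∣_∣) (∪-identityˡ p)
∣⁅x⁆∪p∣≡1+∣p∣ {x = zero}  {inside ∷ _}  x∉p = contradiction here x∉p
∣⁅x⁆∪p∣≡1+∣p∣ {x = suc _} {outside ∷ _} x∉p = ∣⁅x⁆∪p∣≡1+∣p∣ (x∉p ∘ there)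
∣⁅x⁆∪p∣≡1+∣p∣ {x = suc _} {inside ∷ _}  x∉p = cong suc (∣⁅x⁆∪p∣≡1+∣p∣ (x∉p ∘ there))

p⊆q∧∣p∣≡∣q∣⇒p≡q : ∀ {n} {p q : Subset n} → p ⊆ q → ∣ p ∣ ≡ ∣ q ∣ → p ≡ q
p⊆q∧∣p∣≡∣q∣⇒p≡q {p = []}          {[]}          _   _  = refl
p⊆q∧∣p∣≡∣q∣⇒p≡q {p = inside ∷ _}  {inside ∷ _}  p⊆q eq =
  cong (inside ∷_) (p⊆q∧∣p∣≡∣q∣⇒p≡q (drop-∷-⊆ p⊆q) (suc-injective eq))
p⊆q∧∣p∣≡∣q∣⇒p≡q {p = inside ∷ _}  {outside ∷ _} p⊆q _  with () ← p⊆q here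
p⊆q∧∣p∣≡∣q∣⇒p≡q {p = outside ∷ _} {outside ∷ _} p⊆q eq =
  cong (outside ∷_) (p⊆q∧∣p∣≡∣q∣⇒p≡q (drop-∷-⊆ p⊆q) eq)
p⊆q∧∣p∣≡∣q∣⇒p≡q {p = outside ∷ _} {inside ∷ _}  p⊆q eq =
  contradiction eq (<⇒≢ (s≤s (p⊆q⇒∣p∣≤∣q∣ (drop-∷-⊆ p⊆q))))

module _ {n : ℕ} where

  x∈⁅y⁆∪⁅z⁆⁻ : ∀ {x y z : Fin n} → x ∈ ⁅ y ⁆ ∪ ⁅ z ⁆ → x ≡ y ⊎ x ≡ z
  x∈⁅y⁆∪⁅z⁆⁻ {y = y} {z} = Sum.map (x∈⁅y⁆⇒x≡y y) (x∈⁅y⁆⇒x≡y z) ∘ x∈p∪q⁻ ⁅ y ⁆ ⁅ z ⁆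

  x∈⁅y⁆∪⁅z⁆⁺ : ∀ {x y z : Fin n} → x ≡ y ⊎ x ≡ z → x ∈ ⁅ y ⁆ ∪ ⁅ z ⁆
  x∈⁅y⁆∪⁅z⁆⁺ (inj₁ refl) = x∈p∪q⁺ (inj₁ (x∈⁅x⁆ _))
  x∈⁅y⁆∪⁅z⁆⁺ (inj₂ refl) = x∈p∪q⁺ (inj₂ (x∈⁅x⁆ _))

  x∉⁅y⁆∪⁅z⁆ : ∀ {x y z : Fin n} → x ≢ y → x ≢ z → x ∉ ⁅ y ⁆ ∪ ⁅ z ⁆
  x∉⁅y⁆∪⁅z⁆ x≢y x≢z = Sum.[ x≢y , x≢z ] ∘ x∈⁅y⁆∪⁅z⁆⁻

  x∈∁[p∪⁅y⁆∪⁅z⁆]⁻ : ∀ {p : Subset n} {x y z} →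
                    x ∈ ∁ (p ∪ (⁅ y ⁆ ∪ ⁅ z ⁆)) → x ∉ p × x ≢ y × x ≢ z
  x∈∁[p∪⁅y⁆∪⁅z⁆]⁻ x∈ = x∉ ∘ inj₁ , x∉ ∘ inj₂ ∘ x∈⁅y⁆∪⁅z⁆⁺ ∘ inj₁ , x∉ ∘ inj₂ ∘ x∈⁅y⁆∪⁅z⁆⁺ ∘ inj₂
    where x∉ = x∈∁p⇒x∉p x∈ ∘ x∈p∪q⁺

  x∈∁[p∪⁅y⁆∪⁅z⁆]⁺ : ∀ {p : Subset n} {x y z} →
                    x ∉ p → x ≢ y → x ≢ z → x ∈ ∁ (p ∪ (⁅ y ⁆ ∪ ⁅ z ⁆))
  x∈∁[p∪⁅y⁆∪⁅z⁆]⁺ x∉p x≢y x≢z = x∉p⇒x∈∁p (Sum.[ x∉p , x∉⁅y⁆∪⁅z⁆ x≢y x≢z ] ∘ x∈p∪q⁻ _ _)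

  ∣⁅x⁆∪⁅y⁆∪p∣≡2+∣p∣ : ∀ {x y : Fin n} {p} →
                      x ≢ y → x ∉ p → y ∉ p → ∣ (⁅ x ⁆ ∪ ⁅ y ⁆) ∪ p ∣ ≡ 2 + ∣ p ∣
  ∣⁅x⁆∪⁅y⁆∪p∣≡2+∣p∣ {x} {y} {p} x≢y x∉p y∉p = begin
    ∣ (⁅ x ⁆ ∪ ⁅ y ⁆) ∪ p ∣ ≡⟨ cong ∣_∣ (∪-assoc ⁅ x ⁆ ⁅ y ⁆ p) ⟩
    ∣ ⁅ x ⁆ ∪ (⁅ y ⁆ ∪ p) ∣ ≡⟨ ∣⁅x⁆∪p∣≡1+∣p∣ (Sum.[ x≢y ∘ x∈⁅y⁆⇒x≡y y , x∉p ] ∘ x∈p∪q⁻ ⁅ y ⁆ p) ⟩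
    suc ∣ ⁅ y ⁆ ∪ p ∣       ≡⟨ cong suc (∣⁅x⁆∪p∣≡1+∣p∣ y∉p) ⟩
    2 + ∣ p ∣               ∎

  ⁅x⁆∪⁅y⁆⊆⁅u⁆∪⁅w⁆ : ∀ {x y u w : Fin n} → u ≢ w → u ∈ ⁅ x ⁆ ∪ ⁅ y ⁆ → w ∈ ⁅ x ⁆ ∪ ⁅ y ⁆ →
                    ⁅ x ⁆ ∪ ⁅ y ⁆ ⊆ ⁅ u ⁆ ∪ ⁅ w ⁆
  ⁅x⁆∪⁅y⁆⊆⁅u⁆∪⁅w⁆ u≢w u∈ w∈ with x∈⁅y⁆∪⁅z⁆⁻ u∈ | x∈⁅y⁆∪⁅z⁆⁻ w∈
  ... | inj₁ refl | inj₁ refl = contradiction refl u≢w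
  ... | inj₁ refl | inj₂ refl = id
  ... | inj₂ refl | inj₁ refl = x∈⁅y⁆∪⁅z⁆⁺ ∘ Sum.swap ∘ x∈⁅y⁆∪⁅z⁆⁻
  ... | inj₂ refl | inj₂ refl = contradiction refl u≢w

  other-member : ∀ {x y u : Fin n} → x ≢ y → u ∈ ⁅ x ⁆ ∪ ⁅ y ⁆ →
                 ∃[ w ] (w ∈ ⁅ x ⁆ ∪ ⁅ y ⁆ × u ≢ w)
  other-member {x} {y} x≢y u∈ with x∈⁅y⁆∪⁅z⁆⁻ u∈
  ... | inj₁ refl = y , x∈⁅y⁆∪⁅z⁆⁺ (inj₂ refl) , x≢y
  ... | inj₂ refl = x , x∈⁅y⁆∪⁅z⁆⁺ (inj₁ refl) , x≢y ∘ sym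

IsInducedPath : {A : Set} → (A → A → Set) → (m : ℕ) → (Fin (suc m) → A) → Set
IsInducedPath E m f = ∀ i j → E (f i) (f j) ⇔ ∣ toℕ i - toℕ j ∣ ≡ 1

InducedPath : {A : Set} → (A → A → Set) → A → A → Set
InducedPath {A} E a b =
  ∃[ m ] Σ (Fin (suc m) → A) λ f → IsInducedPath E m f × f zero ≡ a × f (fromℕ m) ≡ b

InducedPath-reverse : ∀ {A : Set} {E : A → A → Set} {a b} → InducedPath E a b → InducedPath E b a
InducedPath-reverse {E = E} (m , f , f-induced , f₀≡a , fₘ≡b) =
  m , f ∘ opposite , reversed , fₘ≡b , trans (cong f (opposite-involutive zero)) f₀≡a
  where
  ∣opposite-opposite∣ : ∀ i j → ∣ toℕ (opposite i) - toℕ (opposite j) ∣ ≡ ∣ toℕ i - toℕ j ∣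
  ∣opposite-opposite∣ i j = trans (cong₂ ∣_-_∣ (opposite-prop i) (opposite-prop j))
                                  (∣[o∸m]-[o∸n]∣≡∣m-n∣ (toℕ≤pred[n] i) (toℕ≤pred[n] j))
  reversed : IsInducedPath E m (f ∘ opposite)
  reversed i j = subst (λ d → E (f (opposite i)) (f (opposite j)) ⇔ d ≡ 1)
                       (∣opposite-opposite∣ i j) (f-induced (opposite i) (opposite j))

module CycleGraph {L : ℕ} where

  open import Function.Endo.Propositional (Fin (suc L)) using (_^_) public

  next : Fin (suc L) → Fin (suc L)
  next i with L ℕ.≟ toℕ i
  ... | yes _   = zero
  ... | no  L≢i = suc (lower₁ i L≢i)

  next-CycAdj : ∀ i → CycAdj i (next i)
  next-CycAdj i with L ℕ.≟ toℕ i
  ... | yes L≡i = inj₂ (sym L≡i , refl)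
  ... | no  L≢i = inj₁ (cong suc (toℕ-lower₁ i L≢i))

  CycAdj-functional : ∀ {i j k : Fin (suc L)} → CycAdj i j → CycAdj i k → j ≡ k
  CycAdj-functional (inj₁ j≡1+i) (inj₁ k≡1+i) = toℕ-injective (trans j≡1+i (sym k≡1+i))
  CycAdj-functional {j = j} (inj₁ j≡1+i) (inj₂ (i≡L , _)) =
    contradiction (trans j≡1+i (cong suc i≡L)) (<⇒≢ (toℕ<n j))
  CycAdj-functional {k = k} (inj₂ (i≡L , _)) (inj₁ k≡1+i) =
    contradiction (trans k≡1+i (cong suc i≡L)) (<⇒≢ (toℕ<n k))
  CycAdj-functional (inj₂ (_ , j≡0)) (inj₂ (_ , k≡0)) = toℕ-injective (trans j≡0 (sym k≡0))

  CycAdj-injective : ∀ {i j k : Fin (suc L)} → CycAdj i k → CycAdj j k → i ≡ j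
  CycAdj-injective (inj₁ k≡1+i) (inj₁ k≡1+j) =
    toℕ-injective (suc-injective (trans (sym k≡1+i) k≡1+j))
  CycAdj-injective (inj₁ k≡1+i) (inj₂ (_ , k≡0)) = contradiction (trans (sym k≡0) k≡1+i) 0≢1+n
  CycAdj-injective (inj₂ (_ , k≡0)) (inj₁ k≡1+j) = contradiction (trans (sym k≡0) k≡1+j) 0≢1+n
  CycAdj-injective (inj₂ (i≡L , _)) (inj₂ (j≡L , _)) = toℕ-injective (trans i≡L (sym j≡L))

  CycAdj⇒≡next : ∀ {i j : Fin (suc L)} → CycAdj i j → j ≡ next i
  CycAdj⇒≡next i~j = CycAdj-functional i~j (next-CycAdj _)

  next-injective : ∀ {i j} → next i ≡ next j → i ≡ j
  next-injective {i} {j} eq =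
    CycAdj-injective (next-CycAdj i) (subst (CycAdj j) (sym eq) (next-CycAdj j))

  toℕ-next^ : ∀ k x → k ≤ L →
              toℕ ((next ^ k) x) ≡ toℕ x + k ⊎ toℕ ((next ^ k) x) + suc L ≡ toℕ x + k
  toℕ-next^ zero    x _   = inj₁ (sym (+-identityʳ _))
  toℕ-next^ (suc k) x k<L with toℕ-next^ k x (<⇒≤ k<L) | next-CycAdj ((next ^ k) x)
  ... | inj₁ unwrapped | inj₁ step =
    inj₁ (trans step (trans (cong suc unwrapped) (sym (+-suc _ k))))
  ... | inj₂ wrapped   | inj₁ step =
    inj₂ (trans (cong (_+ suc L) step) (trans (cong suc wrapped) (sym (+-suc _ k))))
  ... | inj₁ unwrapped | inj₂ (y≡L , step) =
    inj₂ (trans (cong (_+ suc L) step)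
                (trans (cong suc (trans (sym y≡L) unwrapped)) (sym (+-suc _ k))))
  ... | inj₂ wrapped   | inj₂ (y≡L , _) =
    contradiction (trans (cong (_+ suc L) (sym y≡L)) wrapped)
                  (<⇒≢ (+-mono-≤-< (toℕ≤pred[n] x) (m≤n⇒m≤1+n k<L)) ∘ sym)

  next^-aperiodic : ∀ k x → 0 < k → k ≤ L → (next ^ k) x ≢ x
  next^-aperiodic k x 0<k k≤L fixed with toℕ-next^ k x k≤L
  ... | inj₁ unwrapped = contradiction
    (+-cancelˡ-≡ (toℕ x) 0 k (trans (+-identityʳ _) (trans (cong toℕ (sym fixed)) unwrapped)))
    (<⇒≢ 0<k)
  ... | inj₂ wrapped = contradiction
    (+-cancelˡ-≡ (toℕ x) (suc L) k (trans (cong (λ y → toℕ y + suc L) (sym fixed)) wrapped))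
    (<⇒≢ (s≤s k≤L) ∘ sym)

  Adj : Fin (suc L) → Fin (suc L) → Set
  Adj i j = CycAdj i j ⊎ CycAdj j i

  Adj-irreflexive : 1 ≤ L → ∀ {i} → ¬ Adj i i
  Adj-irreflexive 1≤L {i} i~i =
    next^-aperiodic 1 i (s≤s z≤n) 1≤L (sym (CycAdj⇒≡next (Sum.reduce i~i)))

  adjacentPath : 1 ≤ L → ∀ {α β} → Adj α β → InducedPath Adj α β
  adjacentPath 1≤L {α} {β} α~β = 1 , f , f-induced , refl , refl
    where
    f : Fin 2 → Fin (suc L)
    f zero       = α
    f (suc zero) = β
    f-induced : IsInducedPath Adj 1 f
    f-induced zero       zero       = mk⇔ (λ α~α → contradiction α~α (Adj-irreflexive 1≤L)) λ ()
    f-induced zero       (suc zero) = mk⇔ (λ _ → refl) (λ _ → α~β)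
    f-induced (suc zero) zero       = mk⇔ (λ _ → refl) (λ _ → Sum.swap α~β)
    f-induced (suc zero) (suc zero) = mk⇔ (λ β~β → contradiction β~β (Adj-irreflexive 1≤L)) λ ()

  segmentPath : ∀ {α β} → toℕ α ≤ toℕ β → ¬ (toℕ α ≡ 0 × toℕ β ≡ L) → InducedPath Adj α β
  segmentPath {α} {β} α≤β no-wrap = m , f , f-induced , f₀≡α , fₘ≡β
    where
    a = toℕ α
    m = toℕ β ∸ a
    a+t<1+L : ∀ (t : Fin (suc m)) → a + toℕ t < suc L
    a+t<1+L t = s≤s (≤-trans (+-monoʳ-≤ a (toℕ≤pred[n] t))
                             (≤-trans (≤-reflexive (m+[n∸m]≡n α≤β)) (toℕ≤pred[n] β)))
    f : Fin (suc m) → Fin (suc L)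
    f t = fromℕ< (a+t<1+L t)
    toℕ-f : ∀ t → toℕ (f t) ≡ a + toℕ t
    toℕ-f t = toℕ-fromℕ< (a+t<1+L t)
    CycAdj-f⇔ : ∀ t u → CycAdj (f t) (f u) ⇔ toℕ u ≡ suc (toℕ t)
    CycAdj-f⇔ t u = mk⇔ ⇒step step⇒
      where
      ⇒step : CycAdj (f t) (f u) → toℕ u ≡ suc (toℕ t)
      ⇒step (inj₁ fu≡1+ft) = +-cancelˡ-≡ a _ _ (begin
        a + toℕ u       ≡⟨ toℕ-f u ⟨
        toℕ (f u)       ≡⟨ fu≡1+ft ⟩
        suc (toℕ (f t)) ≡⟨ cong suc (toℕ-f t) ⟩
        suc (a + toℕ t) ≡⟨ +-suc a (toℕ t) ⟨
        a + suc (toℕ t) ∎)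
      ⇒step (inj₂ (ft≡L , fu≡0)) = contradiction (a≡0 , β≡L) no-wrap
        where
        a≡0 : a ≡ 0
        a≡0 = m+n≡0⇒m≡0 a (trans (sym (toℕ-f u)) fu≡0)
        L≤β : L ≤ toℕ β
        L≤β = ≤-trans (≤-reflexive (trans (sym ft≡L) (trans (toℕ-f t) (cong (_+ toℕ t) a≡0))))
                      (≤-trans (toℕ≤pred[n] t) (m∸n≤m (toℕ β) a))
        β≡L : toℕ β ≡ L
        β≡L = ≤-antisym (toℕ≤pred[n] β) L≤β
      step⇒ : toℕ u ≡ suc (toℕ t) → CycAdj (f t) (f u)
      step⇒ u≡1+t = inj₁ (begin
        toℕ (f u)       ≡⟨ toℕ-f u ⟩
        a + toℕ u       ≡⟨ cong (a +_) u≡1+t ⟩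
        a + suc (toℕ t) ≡⟨ +-suc a (toℕ t) ⟩
        suc (a + toℕ t) ≡⟨ cong suc (toℕ-f t) ⟨
        suc (toℕ (f t)) ∎)
    f-induced : IsInducedPath Adj m f
    f-induced t u = ⇔-trans (CycAdj-f⇔ t u ⊎-⇔ CycAdj-f⇔ u t) (⇔-sym ∣m-n∣≡1⇔)
    f₀≡α : f zero ≡ α
    f₀≡α = toℕ-injective (trans (toℕ-f zero) (+-identityʳ a))
    fₘ≡β : f (fromℕ m) ≡ β
    fₘ≡β = toℕ-injective
      (trans (toℕ-f (fromℕ m)) (trans (cong (a +_) (toℕ-fromℕ m)) (m+[n∸m]≡n α≤β)))

  -- The segment α, α + 1, …, β has a chord only if α = 0 and β = L; then α and β are adjacent.
  ascendingPath : 1 ≤ L → ∀ {α β} → toℕ α ≤ toℕ β → InducedPath Adj α β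
  ascendingPath 1≤L {α} {β} α≤β with (toℕ α ℕ.≟ 0) ×-dec (toℕ β ℕ.≟ L)
  ... | yes (α≡0 , β≡L) = adjacentPath 1≤L (inj₂ (inj₂ (β≡L , α≡0)))
  ... | no  no-wrap      = segmentPath α≤β no-wrap

  cycle-inducedPath : 1 ≤ L → ∀ α β → InducedPath Adj α β
  cycle-inducedPath 1≤L α β with toℕ α ≤? toℕ β
  ... | yes α≤β = ascendingPath 1≤L α≤β
  ... | no  α≰β = InducedPath-reverse {E = Adj} (ascendingPath 1≤L (<⇒≤ (≰⇒> α≰β)))

ShareRidge : ∀ {n} → ℕ → Complex n → Subset n → Subset n → Set
ShareRidge r K F G = K (F ∩ G) × ∣ F ∩ G ∣ ≡ r

module Cocycle (r : ℕ) {k : ℕ} (v : Fin (3 + k) → Fin (r + 3)) (v-inj : Injective _≡_ _≡_ v) where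

  open CycleGraph {2 + k}
  open BooleanAlgebraProperties (∪-∩-booleanAlgebra (r + 3)) using (deMorgan₂; ¬-involutive)

  C : Cycle (r + 3)
  C = record { len = 3 + k ; len≥3 = s≤s (s≤s (s≤s z≤n)) ; vert = v ; inj = v-inj }

  K : Complex (r + 3)
  K = cocycle C

  edge : Fin (3 + k) → Subset (r + 3)
  edge x = edgeSet C x (next x)

  facet : Fin (3 + k) → Subset (r + 3)
  facet x = ∁ (edge x)

  v-≢ : ∀ {i j} → i ≢ j → v i ≢ v j
  v-≢ i≢j = i≢j ∘ v-inj

  next≢ : ∀ x → next x ≢ x
  next≢ x = next^-aperiodic 1 x (s≤s z≤n) (s≤s z≤n)

  next²≢ : ∀ x → next (next x) ≢ x
  next²≢ x = next^-aperiodic 2 x (s≤s z≤n) (s≤s (s≤s z≤n))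

  v∈edge : ∀ x → v x ∈ edge x
  v∈edge x = x∈⁅y⁆∪⁅z⁆⁺ (inj₁ refl)

  v-next∈edge : ∀ x → v (next x) ∈ edge x
  v-next∈edge x = x∈⁅y⁆∪⁅z⁆⁺ (inj₂ refl)

  ∣edge∣≡2 : ∀ x → ∣ edge x ∣ ≡ 2
  ∣edge∣≡2 x =
    trans (∣⁅x⁆∪p∣≡1+∣p∣ (x≢y⇒x∉⁅y⁆ (v-≢ (next≢ x ∘ sym)))) (cong suc (∣⁅x⁆∣≡1 (v (next x))))

  ∣facet∣≡1+r : ∀ x → ∣ facet x ∣ ≡ suc r
  ∣facet∣≡1+r x = begin
    ∣ ∁ (edge x) ∣     ≡⟨ ∣∁p∣≡n∸∣p∣ (edge x) ⟩
    r + 3 ∸ ∣ edge x ∣ ≡⟨ cong (r + 3 ∸_) (∣edge∣≡2 x) ⟩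
    r + 3 ∸ 2          ≡⟨ cong (_∸ 2) (+-comm r 3) ⟩
    suc r              ∎

  ⊆facet⇒face : ∀ {F} x → F ⊆ facet x → K F
  ⊆facet⇒face x F⊆ = x , next x , next-CycAdj x , F⊆

  face⇒⊆facet : ∀ {F} → K F → ∃[ x ] F ⊆ facet x
  face⇒⊆facet (i , j , i~j , F⊆) with refl ← CycAdj⇒≡next i~j = i , F⊆

  facet-rFace : ∀ x → RFace r K (facet x)
  facet-rFace x = ⊆facet⇒face x ⊆-refl , ∣facet∣≡1+r x

  rFace⇒facet : ∀ {F} → RFace r K F → ∃[ x ] F ≡ facet x
  rFace⇒facet (K-F , ∣F∣≡1+r) with face⇒⊆facet K-F
  ... | x , F⊆ = x , p⊆q∧∣p∣≡∣q∣⇒p≡q F⊆ (trans ∣F∣≡1+r (sym (∣facet∣≡1+r x)))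

  off-cycle⊆facet : ∀ {T p x} → (∀ i → v i ∉ T) → (∀ {z} → z ∈ p → z ∉ edge x) → T ∪ p ⊆ facet x
  off-cycle⊆facet {T} {p} {x} v∉T p-avoids-edge =
    x∉p⇒x∈∁p ∘ Sum.[ T-avoids-edge , p-avoids-edge ] ∘ x∈p∪q⁻ T p
    where
    T-avoids-vertex : ∀ {z i} → z ∈ T → z ≢ v i
    T-avoids-vertex z∈T refl = v∉T _ z∈T
    T-avoids-edge : ∀ {z} → z ∈ T → z ∉ edge x
    T-avoids-edge z∈T = Sum.[ T-avoids-vertex z∈T , T-avoids-vertex z∈T ] ∘ x∈⁅y⁆∪⁅z⁆⁻

  Apart : Fin (3 + k) → Fin (3 + k) → Set
  Apart x y = x ≢ y × y ≢ next x × x ≢ next y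

  edge-disjoint : ∀ {x y z} → Apart x y → z ∈ edge x → z ∉ edge y
  edge-disjoint (x≢y , y≢x' , x≢y') z∈ex z∈ey with x∈⁅y⁆∪⁅z⁆⁻ z∈ex | x∈⁅y⁆∪⁅z⁆⁻ z∈ey
  ... | inj₁ refl | inj₁ vx≡vy   = x≢y (v-inj vx≡vy)
  ... | inj₁ refl | inj₂ vx≡vy'  = x≢y' (v-inj vx≡vy')
  ... | inj₂ refl | inj₁ vx'≡vy  = y≢x' (sym (v-inj vx'≡vy))
  ... | inj₂ refl | inj₂ vx'≡vy' = x≢y (next-injective (v-inj vx'≡vy'))

  ∣edge∪edge∣≡2 : ∀ x → ∣ edge x ∪ edge x ∣ ≡ 2
  ∣edge∪edge∣≡2 x = trans (cong ∣_∣ (∪-idem (edge x))) (∣edge∣≡2 x)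

  ∣edge∪edge-next∣≡3 : ∀ x → ∣ edge x ∪ edge (next x) ∣ ≡ 3
  ∣edge∪edge-next∣≡3 x = begin
    ∣ (⁅ a ⁆ ∪ ⁅ b ⁆) ∪ (⁅ b ⁆ ∪ ⁅ c ⁆) ∣ ≡⟨ cong ∣_∣ (∪-assoc ⁅ a ⁆ ⁅ b ⁆ _) ⟩
    ∣ ⁅ a ⁆ ∪ (⁅ b ⁆ ∪ (⁅ b ⁆ ∪ ⁅ c ⁆)) ∣ ≡⟨ cong (λ p → ∣ ⁅ a ⁆ ∪ p ∣) b∪b∪c≡b∪c ⟩
    ∣ ⁅ a ⁆ ∪ (⁅ b ⁆ ∪ ⁅ c ⁆) ∣           ≡⟨ ∣⁅x⁆∪p∣≡1+∣p∣ a∉⁅b⁆∪⁅c⁆ ⟩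
    suc ∣ edge (next x) ∣                 ≡⟨ cong suc (∣edge∣≡2 (next x)) ⟩
    3                                     ∎
    where
    a = v x
    b = v (next x)
    c = v (next (next x))
    a∉⁅b⁆∪⁅c⁆ : a ∉ ⁅ b ⁆ ∪ ⁅ c ⁆
    a∉⁅b⁆∪⁅c⁆ = x∉⁅y⁆∪⁅z⁆ (v-≢ (next≢ x ∘ sym)) (v-≢ (next²≢ x ∘ sym))
    b∪b∪c≡b∪c : ⁅ b ⁆ ∪ (⁅ b ⁆ ∪ ⁅ c ⁆) ≡ ⁅ b ⁆ ∪ ⁅ c ⁆
    b∪b∪c≡b∪c = trans (sym (∪-assoc ⁅ b ⁆ ⁅ b ⁆ ⁅ c ⁆)) (cong (_∪ ⁅ c ⁆) (∪-idem ⁅ b ⁆))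

  ∣edge∪edge∣≡4 : ∀ {x y} → Apart x y → ∣ edge x ∪ edge y ∣ ≡ 4
  ∣edge∪edge∣≡4 {x} {y} apart = trans
    (∣⁅x⁆∪⁅y⁆∪p∣≡2+∣p∣ (v-≢ (next≢ x ∘ sym)) (edge-disjoint apart (v∈edge x))
                                             (edge-disjoint apart (v-next∈edge x)))
    (cong (2 +_) (∣edge∣≡2 y))

  Adj⇒∣edge∪edge∣≡3 : ∀ {x y} → Adj x y → ∣ edge x ∪ edge y ∣ ≡ 3
  Adj⇒∣edge∪edge∣≡3 {x} (inj₁ x~y) with refl ← CycAdj⇒≡next x~y = ∣edge∪edge-next∣≡3 x
  Adj⇒∣edge∪edge∣≡3 {y = y} (inj₂ y~x) with refl ← CycAdj⇒≡next y~x =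
    trans (cong ∣_∣ (∪-comm (edge (next y)) (edge y))) (∣edge∪edge-next∣≡3 y)

  ∣edge∪edge∣≡3⇒Adj : ∀ {x y} → ∣ edge x ∪ edge y ∣ ≡ 3 → Adj x y
  ∣edge∪edge∣≡3⇒Adj {x} {y} size with x Fin.≟ y | y Fin.≟ next x | x Fin.≟ next y
  ... | yes refl | _        | _        = contradiction (trans (sym (∣edge∪edge∣≡2 x)) size) λ ()
  ... | no _     | yes y≡x' | _        = inj₁ (subst (CycAdj x) (sym y≡x') (next-CycAdj x))
  ... | no _     | no _     | yes x≡y' = inj₂ (subst (CycAdj y) (sym x≡y') (next-CycAdj y))
  ... | no x≢y   | no y≢x'  | no x≢y'  =
    contradiction (trans (sym (∣edge∪edge∣≡4 (x≢y , y≢x' , x≢y'))) size) λ ()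

  ShareRidge⇔Adj : ∀ x y → ShareRidge r K (facet x) (facet y) ⇔ Adj x y
  ShareRidge⇔Adj x y = mk⇔
    (λ (_ , ∣∩∣≡r) → ∣edge∪edge∣≡3⇒Adj (∸-cancelˡ-≡ (∣p∣≤n (edge x ∪ edge y)) (m≤n+m 3 r)
                                          (trans (sym ∣facet∩facet∣) (trans ∣∩∣≡r (sym (m+n∸n≡m r 3))))))
    (λ x~y → ⊆facet⇒face x (p∩q⊆p _ _) ,
             trans ∣facet∩facet∣ (trans (cong (r + 3 ∸_) (Adj⇒∣edge∪edge∣≡3 x~y)) (m+n∸n≡m r 3)))
    where
    ∣facet∩facet∣ : ∣ facet x ∩ facet y ∣ ≡ r + 3 ∸ ∣ edge x ∪ edge y ∣
    ∣facet∩facet∣ =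
      trans (cong ∣_∣ (sym (deMorgan₂ (edge x) (edge y)))) (∣∁p∣≡n∸∣p∣ (edge x ∪ edge y))

  rPathConnected : RPathConnected r K
  rPathConnected F G F-rFace G-rFace with rFace⇒facet F-rFace | rFace⇒facet G-rFace
  ... | α , refl | β , refl with cycle-inducedPath (s≤s z≤n) α β
  ... | m , f , f-induced , f₀≡α , fₘ≡β =
    m , facet ∘ f ,
    ((λ t → facet-rFace (f t)) , λ t u → ⇔-trans (ShareRidge⇔Adj (f t) (f u)) (f-induced t u)) ,
    cong facet f₀≡α , cong facet fₘ≡β

  Arc : Fin (r + 3) → Fin (r + 3) → Set
  Arc a b = ∃[ x ] v x ≡ a × v (next x) ≡ b

  Edge : Fin (r + 3) → Fin (r + 3) → Set
  Edge a b = Arc a b ⊎ Arc b a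

  Arc-functional : ∀ {a b c} → Arc a b → Arc a c → b ≡ c
  Arc-functional (x , refl , refl) (y , vy≡vx , refl) = cong (v ∘ next) (sym (v-inj vy≡vx))

  Arc-injective : ∀ {a b c} → Arc a c → Arc b c → a ≡ b
  Arc-injective (x , refl , refl) (y , refl , vy'≡vx') =
    cong v (next-injective (v-inj (sym vy'≡vx')))

  Edge-degree≤2 : ∀ {w a b c} → Edge w a → Edge w b → Edge w c → a ≡ b ⊎ a ≡ c ⊎ b ≡ c
  Edge-degree≤2 (inj₁ wa) (inj₁ wb) _         = inj₁ (Arc-functional wa wb)
  Edge-degree≤2 (inj₂ aw) (inj₂ bw) _         = inj₁ (Arc-injective aw bw)
  Edge-degree≤2 (inj₁ wa) (inj₂ _)  (inj₁ wc) = inj₂ (inj₁ (Arc-functional wa wc))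
  Edge-degree≤2 (inj₁ _)  (inj₂ bw) (inj₂ cw) = inj₂ (inj₂ (Arc-injective bw cw))
  Edge-degree≤2 (inj₂ _)  (inj₁ wb) (inj₁ wc) = inj₂ (inj₂ (Arc-functional wb wc))
  Edge-degree≤2 (inj₂ aw) (inj₁ _)  (inj₂ cw) = inj₂ (inj₁ (Arc-injective aw cw))

  Arc-continue : ∀ {a b c} → Arc a b → Edge b c → c ≢ a → Arc b c
  Arc-continue _  (inj₁ bc) _   = bc
  Arc-continue ab (inj₂ cb) c≢a = contradiction (Arc-injective cb ab) c≢a

  no-Arc-4-cycle : 4 ≤ 2 + k → ∀ {a b c d} → Arc a b → Arc b c → Arc c d → Arc d a → ⊥
  no-Arc-4-cycle 4≤L (x , refl , refl) (y , vy≡vx' , refl) (z , vz≡vy' , refl)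
                     (w , vw≡vz' , vw'≡vx) =
    next^-aperiodic 4 x (s≤s z≤n) 4≤L (sym (begin
      x                  ≡⟨ v-inj vw'≡vx ⟨
      next w             ≡⟨ cong next (v-inj vw≡vz') ⟩
      (next ^ 2) z       ≡⟨ cong (next ^ 2) (v-inj vz≡vy') ⟩
      (next ^ 3) y       ≡⟨ cong (next ^ 3) (v-inj vy≡vx') ⟩
      (next ^ 4) x       ∎))

  no-Edge-4-cycle : 4 ≤ 2 + k → ∀ {a b c d} →
                    Edge a b → Edge b c → Edge c d → Edge d a → a ≢ c → b ≢ d → ⊥
  no-Edge-4-cycle 4≤L (inj₁ ab) bc cd da a≢c b≢d = no-Arc-4-cycle 4≤L ab bc′ cd′ da′
    where
    bc′ = Arc-continue ab bc (a≢c ∘ sym)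
    cd′ = Arc-continue bc′ cd (b≢d ∘ sym)
    da′ = Arc-continue cd′ da a≢c
  no-Edge-4-cycle 4≤L (inj₂ ba) bc cd da a≢c b≢d = no-Arc-4-cycle 4≤L ba ad dc cb
    where
    ad = Arc-continue ba (Sum.swap da) (b≢d ∘ sym)
    dc = Arc-continue ad (Sum.swap cd) (a≢c ∘ sym)
    cb = Arc-continue dc (Sum.swap bc) b≢d

  module _ (S : Subset (r + 3)) where

    Covers : (a b c d : Fin (r + 3)) → Set
    Covers a b c d = ∀ {z} → z ∉ S → z ≡ a ⊎ z ≡ b ⊎ z ≡ c ⊎ z ≡ d

    Covers-rotate : ∀ {a b c d} → Covers a b c d → Covers b c d a
    Covers-rotate cover z∉S with cover z∉S
    ... | inj₁ z≡a = inj₂ (inj₂ (inj₂ z≡a))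
    ... | inj₂ z≡b/c/d = Sum.map₂ (Sum.map₂ inj₁) z≡b/c/d

    Covers-rotate₃ : ∀ {a b c d} → Covers a b c d → Covers b c a d
    Covers-rotate₃ cover z∉S with cover z∉S
    ... | inj₁ z≡a               = inj₂ (inj₂ (inj₁ z≡a))
    ... | inj₂ (inj₁ z≡b)        = inj₁ z≡b
    ... | inj₂ (inj₂ (inj₁ z≡c)) = inj₂ (inj₁ z≡c)
    ... | inj₂ (inj₂ (inj₂ z≡d)) = inj₂ (inj₂ (inj₂ z≡d))

    spoke-complement : ∀ {u w} → RFace r K (S ∪ (⁅ u ⁆ ∪ ⁅ w ⁆)) →
                       ∃[ x ] ∁ (S ∪ (⁅ u ⁆ ∪ ⁅ w ⁆)) ≡ edge x
    spoke-complement spoke with rFace⇒facet spoke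
    ... | x , spoke≡facet = x , trans (cong ∁ spoke≡facet) (¬-involutive (edge x))

    beyond-spoke : ∀ {u w} → RFace r K (S ∪ (⁅ u ⁆ ∪ ⁅ w ⁆)) →
                   ∃[ x ] (∀ {z} → z ∉ S → z ≢ u → z ≢ w → z ∈ edge x)
    beyond-spoke spoke with spoke-complement spoke
    ... | x , ∁≡edge = x , λ z∉S z≢u z≢w → subst (_ ∈_) ∁≡edge (x∈∁[p∪⁅y⁆∪⁅z⁆]⁺ z∉S z≢u z≢w)

    opposite-edge : ∀ {u w a b} → RFace r K (S ∪ (⁅ u ⁆ ∪ ⁅ w ⁆)) → Covers u w a b → Edge a b
    opposite-edge {u} {w} {a} {b} spoke cover with spoke-complement spoke
    ... | x , ∁≡edge = orient (endpoint (v∈edge x)) (endpoint (v-next∈edge x))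
      where
      endpoint : ∀ {z} → z ∈ edge x → z ≡ a ⊎ z ≡ b
      endpoint z∈e with x∈∁[p∪⁅y⁆∪⁅z⁆]⁻ (subst (_ ∈_) (sym ∁≡edge) z∈e)
      ... | z∉S , z≢u , z≢w with cover z∉S
      ... | inj₁ z≡u         = contradiction z≡u z≢u
      ... | inj₂ (inj₁ z≡w)  = contradiction z≡w z≢w
      ... | inj₂ (inj₂ z≡a/b) = z≡a/b
      orient : v x ≡ a ⊎ v x ≡ b → v (next x) ≡ a ⊎ v (next x) ≡ b → Edge a b
      orient (inj₁ vx≡a) (inj₂ vx'≡b) = inj₁ (x , vx≡a , vx'≡b)
      orient (inj₂ vx≡b) (inj₁ vx'≡a) = inj₂ (x , vx≡b , vx'≡a)
      orient (inj₁ vx≡a) (inj₁ vx'≡a) = contradiction (v-inj (trans vx'≡a (sym vx≡a))) (next≢ x)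
      orient (inj₂ vx≡b) (inj₂ vx'≡b) = contradiction (v-inj (trans vx'≡b (sym vx≡b))) (next≢ x)

    covers : ∀ {u w p q} {e : Subset (r + 3)} → (∀ {z} → z ∉ S → z ≢ u → z ≢ w → z ∈ e) →
             e ⊆ ⁅ p ⁆ ∪ ⁅ q ⁆ → Covers u w p q
    covers {u} {w} beyond e⊆ {z} z∉S with z Fin.≟ u | z Fin.≟ w
    ... | yes z≡u | _       = inj₁ z≡u
    ... | no _    | yes z≡w = inj₂ (inj₁ z≡w)
    ... | no z≢u  | no z≢w  = inj₂ (inj₂ (x∈⁅y⁆∪⁅z⁆⁻ (e⊆ (beyond z∉S z≢u z≢w))))

    Spokes : ∀ {m} → (Fin m → Fin (r + 3)) → Set
    Spokes d = ∀ i j → CycAdj i j → RFace r K (S ∪ (⁅ d i ⁆ ∪ ⁅ d j ⁆))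

    no-triangle-rim : (d : Fin 3 → Fin (r + 3)) → Injective _≡_ _≡_ d → (∀ i → d i ∉ S) →
                      Spokes d → ⊥
    no-triangle-rim d d-inj d∉S spokes = triangle (beyond-spoke (spokes (# 0) (# 1) (inj₁ refl)))
      where
      triangle : ∃[ x ] (∀ {z} → z ∉ S → z ≢ d (# 0) → z ≢ d (# 1) → z ∈ edge x) → ⊥
      triangle (x , beyond) = fourth (other-member (v-≢ (next≢ x ∘ sym)) d₂∈e)
        where
        d₂∈e : d (# 2) ∈ edge x
        d₂∈e = beyond (d∉S (# 2)) ((λ ()) ∘ d-inj) ((λ ()) ∘ d-inj)
        fourth : ∃[ w ] (w ∈ edge x × d (# 2) ≢ w) → ⊥
        fourth (w , w∈e , d₂≢w) = Sum.[ (λ ()) ∘ d-inj , Sum.[ (λ ()) ∘ d-inj , (λ ()) ∘ d-inj ] ]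
                                        (Edge-degree≤2 w~d₂ w~d₀ w~d₁)
          where
          cover : Covers (d (# 0)) (d (# 1)) (d (# 2)) w
          cover = covers beyond (⁅x⁆∪⁅y⁆⊆⁅u⁆∪⁅w⁆ d₂≢w d₂∈e w∈e)
          w~d₂ = Sum.swap (opposite-edge (spokes (# 0) (# 1) (inj₁ refl)) cover)
          w~d₀ = Sum.swap (opposite-edge (spokes (# 1) (# 2) (inj₁ refl)) (Covers-rotate₃ cover))
          w~d₁ = Sum.swap (opposite-edge (spokes (# 2) (# 0) (inj₂ (refl , refl)))
                                         (Covers-rotate₃ (Covers-rotate₃ cover)))

    no-square-rim : 4 ≤ 2 + k → (d : Fin 4 → Fin (r + 3)) → Injective _≡_ _≡_ d → (∀ i → d i ∉ S) →
                    Spokes d → ⊥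
    no-square-rim 4≤L d d-inj d∉S spokes = square (beyond-spoke (spokes (# 0) (# 1) (inj₁ refl)))
      where
      square : ∃[ x ] (∀ {z} → z ∉ S → z ≢ d (# 0) → z ≢ d (# 1) → z ∈ edge x) → ⊥
      square (x , beyond) =
        no-Edge-4-cycle 4≤L d₀~d₁ d₁~d₂ d₂~d₃ d₃~d₀ ((λ ()) ∘ d-inj) ((λ ()) ∘ d-inj)
        where
        rim∈e : ∀ i → i ≢ # 0 → i ≢ # 1 → d i ∈ edge x
        rim∈e i i≢0 i≢1 = beyond (d∉S i) (i≢0 ∘ d-inj) (i≢1 ∘ d-inj)
        cover : Covers (d (# 0)) (d (# 1)) (d (# 2)) (d (# 3))
        cover = covers beyond
          (⁅x⁆∪⁅y⁆⊆⁅u⁆∪⁅w⁆ ((λ ()) ∘ d-inj) (rim∈e (# 2) (λ ()) (λ ())) (rim∈e (# 3) (λ ()) (λ ())))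
        d₂~d₃ = opposite-edge (spokes (# 0) (# 1) (inj₁ refl)) cover
        d₃~d₀ = opposite-edge (spokes (# 1) (# 2) (inj₁ refl)) (Covers-rotate cover)
        d₀~d₁ = opposite-edge (spokes (# 2) (# 3) (inj₁ refl)) (Covers-rotate (Covers-rotate cover))
        d₁~d₂ = opposite-edge (spokes (# 3) (# 0) (inj₂ (refl , refl)))
                              (Covers-rotate (Covers-rotate (Covers-rotate cover)))

    no-long-rim : ∀ {m} (d : Fin (5 + m) → Fin (r + 3)) → Injective _≡_ _≡_ d → (∀ i → d i ∉ S) →
                  Spokes d → ⊥
    no-long-rim d d-inj d∉S spokes = long (beyond-spoke (spokes (# 0) (# 1) (inj₁ refl)))
      where
      long : ∃[ x ] (∀ {z} → z ∉ S → z ≢ d (# 0) → z ≢ d (# 1) → z ∈ edge x) → ⊥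
      long (x , beyond) =
        Sum.[ (λ ()) ∘ d-inj , (λ ()) ∘ d-inj ] (x∈⁅y⁆∪⁅z⁆⁻ (e⊆⁅d₂⁆∪⁅d₃⁆ (rim∈e (# 4) (λ ()) (λ ()))))
        where
        rim∈e : ∀ i → i ≢ # 0 → i ≢ # 1 → d i ∈ edge x
        rim∈e i i≢0 i≢1 = beyond (d∉S i) (i≢0 ∘ d-inj) (i≢1 ∘ d-inj)
        e⊆⁅d₂⁆∪⁅d₃⁆ : edge x ⊆ ⁅ d (# 2) ⁆ ∪ ⁅ d (# 3) ⁆
        e⊆⁅d₂⁆∪⁅d₃⁆ =
          ⁅x⁆∪⁅y⁆⊆⁅u⁆∪⁅w⁆ ((λ ()) ∘ d-inj) (rim∈e (# 2) (λ ()) (λ ())) (rim∈e (# 3) (λ ()) (λ ()))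

    no-rim : 4 ≤ 2 + k → (D : Cycle (r + 3)) → (∀ i → vert D i ∉ S) →
             (∀ i j → CycAdj i j → RFace r K (S ∪ edgeSet D i j)) → ⊥
    no-rim _   record { len≥3 = s≤s (s≤s (s≤s (z≤n {zero})))         ; vert = d ; inj = d-inj } =
      no-triangle-rim d d-inj
    no-rim 4≤L record { len≥3 = s≤s (s≤s (s≤s (z≤n {suc zero})))    ; vert = d ; inj = d-inj } =
      no-square-rim 4≤L d d-inj
    no-rim _   record { len≥3 = s≤s (s≤s (s≤s (z≤n {suc (suc _)}))) ; vert = d ; inj = d-inj } =
      no-long-rim d d-inj

  wheel-free : 4 ≤ 2 + k → ¬ ContainsWheel r K
  wheel-free 4≤L (S , _ , D , rim∉S , spokes) = no-rim S 4≤L D rim∉S spokes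

module Book (r : ℕ) (v : Fin 3 → Fin (r + 3)) (v-inj : Injective _≡_ _≡_ v) where

  open CycleGraph {2}
  open Cocycle r v v-inj

  -- V ∖ V(C): the edges 0 and 2 of a triangle cover its vertices.
  T : Subset (r + 3)
  T = ∁ (edge (# 0) ∪ edge (# 2))

  ∣T∣≡r : ∣ T ∣ ≡ r
  ∣T∣≡r = begin
    ∣ T ∣                               ≡⟨ ∣∁p∣≡n∸∣p∣ (edge (# 0) ∪ edge (# 2)) ⟩
    r + 3 ∸ ∣ edge (# 0) ∪ edge (# 2) ∣ ≡⟨ cong (r + 3 ∸_) (Adj⇒∣edge∪edge∣≡3 (inj₂ (next-CycAdj (# 2)))) ⟩
    r + 3 ∸ 3                           ≡⟨ m+n∸n≡m r 3 ⟩
    r                                   ∎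

  v∉T : ∀ i → v i ∉ T
  v∉T zero             = x∈p⇒x∉∁p (x∈p∪q⁺ (inj₁ (v∈edge (# 0))))
  v∉T (suc zero)       = x∈p⇒x∉∁p (x∈p∪q⁺ (inj₁ (v-next∈edge (# 0))))
  v∉T (suc (suc zero)) = x∈p⇒x∉∁p (x∈p∪q⁺ (inj₂ (v∈edge (# 2))))

  ∉T⇒on-cycle : ∀ {z} → z ∉ T → ∃[ i ] v i ≡ z
  ∉T⇒on-cycle z∉T with x∈p∪q⁻ (edge (# 0)) (edge (# 2)) (x∉∁p⇒x∈p z∉T)
  ... | inj₁ z∈e₀ = Sum.[ (λ z≡v₀ → # 0 , sym z≡v₀) , (λ z≡v₁ → # 1 , sym z≡v₁) ] (x∈⁅y⁆∪⁅z⁆⁻ z∈e₀)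
  ... | inj₂ z∈e₂ = Sum.[ (λ z≡v₂ → # 2 , sym z≡v₂) , (λ z≡v₀ → # 0 , sym z≡v₀) ] (x∈⁅y⁆∪⁅z⁆⁻ z∈e₂)

  facet≡T∪⁅v⁆ : ∀ {x i} → i ≢ x → i ≢ next x → facet x ≡ T ∪ ⁅ v i ⁆
  facet≡T∪⁅v⁆ {x} {i} i≢x i≢x' =
    sym (p⊆q∧∣p∣≡∣q∣⇒p≡q (off-cycle⊆facet v∉T vi∉edge) (trans ∣T∪⁅vi⁆∣ (sym (∣facet∣≡1+r x))))
    where
    vi∉edge : ∀ {z} → z ∈ ⁅ v i ⁆ → z ∉ edge x
    vi∉edge z∈ with refl ← x∈⁅y⁆⇒x≡y (v i) z∈ = x∉⁅y⁆∪⁅z⁆ (v-≢ i≢x) (v-≢ i≢x')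
    ∣T∪⁅vi⁆∣ : ∣ T ∪ ⁅ v i ⁆ ∣ ≡ suc r
    ∣T∪⁅vi⁆∣ = trans (cong ∣_∣ (∪-comm T ⁅ v i ⁆)) (trans (∣⁅x⁆∪p∣≡1+∣p∣ (v∉T i)) (cong suc ∣T∣≡r))

  isBook : IsBook r K
  isBook = T , ∣T∣≡r , λ F → mk⇔ (face⇒⊆T∪⁅u⁆ F) (⊆T∪⁅u⁆⇒face F)
    where
    face⇒⊆T∪⁅u⁆ : ∀ F → K F → ∃[ u ] (u ∉ T × F ⊆ T ∪ ⁅ u ⁆)
    face⇒⊆T∪⁅u⁆ F K-F with face⇒⊆facet K-F
    ... | x , F⊆ = v (next (next x)) , v∉T _ ,
                   subst (F ⊆_) (facet≡T∪⁅v⁆ (next²≢ x) (next≢ (next x))) F⊆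
    ⊆T∪⁅u⁆⇒face : ∀ F → ∃[ u ] (u ∉ T × F ⊆ T ∪ ⁅ u ⁆) → K F
    ⊆T∪⁅u⁆⇒face F (u , u∉T , F⊆) with ∉T⇒on-cycle u∉T
    ... | i , refl = ⊆facet⇒face (next i)
                       (subst (F ⊆_) (sym (facet≡T∪⁅v⁆ (next≢ i ∘ sym) (next²≢ i ∘ sym))) F⊆)

module Wheel (r : ℕ) (r≥1 : 1 ≤ r) (v : Fin 4 → Fin (r + 3)) (v-inj : Injective _≡_ _≡_ v) where

  open CycleGraph {3}
  open Cocycle r v v-inj

  -- V ∖ V(C): the edges 0 and 2 of a square cover its vertices.
  S : Subset (r + 3)
  S = ∁ (edge (# 0) ∪ edge (# 2))

  1+∣S∣≡r : suc ∣ S ∣ ≡ r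
  1+∣S∣≡r = begin
    suc ∣ S ∣                                 ≡⟨ cong suc (∣∁p∣≡n∸∣p∣ (edge (# 0) ∪ edge (# 2))) ⟩
    suc (r + 3 ∸ ∣ edge (# 0) ∪ edge (# 2) ∣) ≡⟨ cong (λ s → suc (r + 3 ∸ s)) ∣edge₀∪edge₂∣≡4 ⟩
    suc (r + 3 ∸ 4)                           ≡⟨ cong (λ s → suc (s ∸ 4)) (+-comm r 3) ⟩
    suc (r ∸ 1)                               ≡⟨ m+[n∸m]≡n r≥1 ⟩
    r                                         ∎
    where
    ∣edge₀∪edge₂∣≡4 : ∣ edge (# 0) ∪ edge (# 2) ∣ ≡ 4
    ∣edge₀∪edge₂∣≡4 = ∣edge∪edge∣≡4 ((λ ()) , (λ ()) , (λ ()))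

  v∉S : ∀ i → v i ∉ S
  v∉S zero                   = x∈p⇒x∉∁p (x∈p∪q⁺ (inj₁ (v∈edge (# 0))))
  v∉S (suc zero)             = x∈p⇒x∉∁p (x∈p∪q⁺ (inj₁ (v-next∈edge (# 0))))
  v∉S (suc (suc zero))       = x∈p⇒x∉∁p (x∈p∪q⁺ (inj₂ (v∈edge (# 2))))
  v∉S (suc (suc (suc zero))) = x∈p⇒x∉∁p (x∈p∪q⁺ (inj₂ (v-next∈edge (# 2))))

  ∉S⇔on-cycle : ∀ z → z ∉ S ⇔ (∃[ i ] v i ≡ z)
  ∉S⇔on-cycle z = mk⇔ ∉S⇒on-cycle (λ { (i , refl) → v∉S i })
    where
    ∉S⇒on-cycle : z ∉ S → ∃[ i ] v i ≡ z
    ∉S⇒on-cycle z∉S with x∈p∪q⁻ (edge (# 0)) (edge (# 2)) (x∉∁p⇒x∈p z∉S)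
    ... | inj₁ z∈e₀ = Sum.[ (λ z≡v₀ → # 0 , sym z≡v₀) , (λ z≡v₁ → # 1 , sym z≡v₁) ] (x∈⁅y⁆∪⁅z⁆⁻ z∈e₀)
    ... | inj₂ z∈e₂ = Sum.[ (λ z≡v₂ → # 2 , sym z≡v₂) , (λ z≡v₃ → # 3 , sym z≡v₃) ] (x∈⁅y⁆∪⁅z⁆⁻ z∈e₂)

  next³≢ : ∀ x → next (next (next x)) ≢ x
  next³≢ x = next^-aperiodic 3 x (s≤s z≤n) (s≤s (s≤s (s≤s z≤n)))

  facet≡S∪edge : ∀ {x y} → Apart y x → facet x ≡ S ∪ edge y
  facet≡S∪edge {x} {y} apart =
    sym (p⊆q∧∣p∣≡∣q∣⇒p≡q (off-cycle⊆facet v∉S (edge-disjoint apart)) (trans ∣S∪edge∣ (sym (∣facet∣≡1+r x))))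
    where
    ∣S∪edge∣ : ∣ S ∪ edge y ∣ ≡ suc r
    ∣S∪edge∣ = trans (cong ∣_∣ (∪-comm S (edge y)))
                     (trans (∣⁅x⁆∪⁅y⁆∪p∣≡2+∣p∣ (v-≢ (next≢ y ∘ sym)) (v∉S y) (v∉S (next y)))
                            (cong suc 1+∣S∣≡r))

  isWheel : IsWheel r K
  isWheel = S , 1+∣S∣≡r , C , ∉S⇔on-cycle , λ F → mk⇔ (face⇒⊆S∪edge F) (⊆S∪edge⇒face F)
    where
    face⇒⊆S∪edge : ∀ F → K F → ∃[ i ] ∃[ j ] (CycAdj i j × F ⊆ S ∪ edgeSet C i j)
    face⇒⊆S∪edge F K-F with face⇒⊆facet K-F
    ... | x , F⊆ = next (next x) , _ , next-CycAdj _ ,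
                   subst (F ⊆_) (facet≡S∪edge (next²≢ x , next³≢ x ∘ sym , next≢ (next x))) F⊆
    ⊆S∪edge⇒face : ∀ F → ∃[ i ] ∃[ j ] (CycAdj i j × F ⊆ S ∪ edgeSet C i j) → K F
    ⊆S∪edge⇒face F (i , j , i~j , F⊆) with refl ← CycAdj⇒≡next i~j =
      ⊆facet⇒face (next (next i))
        (subst (F ⊆_) (sym (facet≡S∪edge (next²≢ i ∘ sym , next≢ (next i) , next³≢ i ∘ sym))) F⊆)

lemma3p1 : (r : ℕ) → 1 ≤ r → (C : Cycle (r + 3)) →
    RPathConnected r (cocycle C) ×
    (len C ≡ 3 → IsBook r (cocycle C)) ×
    (len C ≡ 4 → IsWheel r (cocycle C)) ×
    (5 ≤ len C → len C ≤ r + 3 → ¬ ContainsWheel r (cocycle C))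
lemma3p1 r r≥1 record { len≥3 = s≤s (s≤s (s≤s z≤n)) ; vert = v ; inj = v-inj } =
  Cocycle.rPathConnected r v v-inj ,
  (λ { refl → Book.isBook r v v-inj }) ,
  (λ { refl → Wheel.isWheel r r≥1 v v-inj }) ,
  (λ 5≤ℓ _ → Cocycle.wheel-free r v v-inj (≤-pred 5≤ℓ))
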